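{- Let $G$ be a good $2\mathcal{C}_{\ge3}$-saturated graph on $n\ge6$ vertices. If there exists a vertex $x\in V(G)$ contained in every cycle of $G$, then $x$ has degree $n-1$ in $G$ and $G-\{x\}$ is a tree; in particular $|E(G)|=2n-3$. Moreover, $n\ge 8$.
   Context: All graphs are finite and simple. A graph is $2\mathcal{C}_{\ge3}$-saturated if it does not contain two vertex-disjoint cycles, but for every pair of non-adjacent vertices $u,v$, $G+uv$ contains two vertex-disjoint cycles. A subdivision of a graph $F$ is obtained by replacing edges of $F$ by internally vertex-disjoint paths with at least one edge. A graph $G$ is good if it is $2$-connected and no graph with fewer edges than $G$ has $G$ as a subdivision. -}

module Defs where

open import Data.Nat using (ℕ; zero; suc; _+_; _<_; _≤_; _<ᵇ_)
open import Data.Fin using (Fin; toℕ)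
open import Data.Fin.Properties using (_≟_)
open import Data.Bool using (Bool; true; false; T; _∧_; _∨_; if_then_else_)
open import Data.List using (List; []; _∷_; _++_; length; map; allFin)
open import Data.Nat.ListAction using (sum)
open import Data.List.Membership.Propositional using (_∈_; _∉_)
open import Data.List.Relation.Unary.Unique.Propositional using (Unique)
open import Data.List.Relation.Unary.Linked using (Linked)
open import Data.Product using (Σ; ∃; ∃-syntax; _×_; _,_)
open import Data.Sum using (_⊎_)
open import Relation.Nullary using (¬_; ⌊_⌋)
open import Relation.Binary.PropositionalEquality using (_≡_; _≢_)

AdjFn : ℕ → Set
AdjFn n = Fin n → Fin n → Bool

record Graph (n : ℕ) : Set where
  field
    adj    : AdjFn n
    sym    : ∀ i j → adj i j ≡ adj j i
    irrefl : ∀ i → adj i i ≡ false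
open Graph public

E : ∀ {n} → AdjFn n → Fin n → Fin n → Set
E A u v = T (A u v)

addEdge : ∀ {n} → AdjFn n → Fin n → Fin n → AdjFn n
addEdge A u v i j =
  A i j ∨ ((⌊ i ≟ u ⌋ ∧ ⌊ j ≟ v ⌋) ∨ (⌊ i ≟ v ⌋ ∧ ⌊ j ≟ u ⌋))

seq : ∀ {n} → Fin n → List (Fin n) → Fin n → List (Fin n)
seq u ms v = u ∷ ms ++ v ∷ []

PathVia : ∀ {n} → AdjFn n → Fin n → Fin n → List (Fin n) → Set
PathVia A u v ms = Unique (seq u ms v) × Linked (E A) (seq u ms v)

-- A cycle with vertex sequence u, ms, w (at least 3 vertices):
-- a path u … w with at least one internal vertex, closed by the edge wu.
IsCycle : ∀ {n} → AdjFn n → Fin n → List (Fin n) → Fin n → Set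
IsCycle A u ms w = PathVia A u w ms × 1 ≤ length ms × E A w u

TwoDisjointCycles : ∀ {n} → AdjFn n → Set
TwoDisjointCycles {n} A =
  Σ (Fin n) λ u₁ → Σ (List (Fin n)) λ ms₁ → Σ (Fin n) λ w₁ →
  Σ (Fin n) λ u₂ → Σ (List (Fin n)) λ ms₂ → Σ (Fin n) λ w₂ →
    IsCycle A u₁ ms₁ w₁ × IsCycle A u₂ ms₂ w₂ ×
    (∀ z → z ∈ seq u₁ ms₁ w₁ → z ∉ seq u₂ ms₂ w₂)

Saturated : ∀ {n} → Graph n → Set
Saturated {n} G =
  ¬ TwoDisjointCycles (adj G) ×
  (∀ (u v : Fin n) → u ≢ v → adj G u v ≡ false →
     TwoDisjointCycles (addEdge (adj G) u v))

Connected : ∀ {n} → Graph n → Set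
Connected {n} G =
  ∀ (u v : Fin n) → u ≡ v ⊎ ∃[ ms ] PathVia (adj G) u v ms

ConnectedMinus : ∀ {n} → Graph n → Fin n → Set
ConnectedMinus {n} G x =
  ∀ (u v : Fin n) → u ≢ x → v ≢ x →
    u ≡ v ⊎ ∃[ ms ] (PathVia (adj G) u v ms × x ∉ ms)

TwoConnected : ∀ {n} → Graph n → Set
TwoConnected {n} G = 3 ≤ n × Connected G × (∀ x → ConnectedMinus G x)

TreeMinus : ∀ {n} → Graph n → Fin n → Set
TreeMinus {n} G x =
  ConnectedMinus G x ×
  (∀ u ms w → IsCycle (adj G) u ms w → x ∈ seq u ms w)

degree : ∀ {n} → Graph n → Fin n → ℕ
degree {n} G v = sum (map (λ j → if adj G v j then 1 else 0) (allFin n))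

edgeCount : ∀ {n} → Graph n → ℕ
edgeCount {n} G =
  sum (map (λ i → sum (map (λ j →
      if adj G i j ∧ (toℕ i <ᵇ toℕ j) then 1 else 0) (allFin n))) (allFin n))

-- F-edge {u,v} listed once, as u < v
FEdge : ∀ {m} → Graph m → Fin m → Fin m → Set
FEdge F u v = E (adj F) u v × toℕ u < toℕ v

Consecutive : ∀ {n} → Fin n → Fin n → List (Fin n) → Set
Consecutive a b xs = ∃[ ys ] ∃[ zs ] xs ≡ ys ++ a ∷ b ∷ zs

record SubdivisionOf {n m : ℕ} (G : Graph n) (F : Graph m) : Set where
  field
    φ        : Fin m → Fin n
    φ-inj    : ∀ a b → φ a ≡ φ b → a ≡ b
    P        : Fin m → Fin m → List (Fin n)
    P-path   : ∀ u v → FEdge F u v → PathVia (adj G) (φ u) (φ v) (P u v)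
    P-branch : ∀ u v → FEdge F u v → ∀ w → w ∈ P u v → ∀ a → φ a ≢ w
    P-disj   : ∀ u v u' v' → FEdge F u v → FEdge F u' v' →
               ¬ (u ≡ u' × v ≡ v') →
               ∀ w → w ∈ P u v → w ∉ P u' v'
    edges    : ∀ a b → E (adj G) a b →
               ∃[ u ] ∃[ v ] (FEdge F u v ×
                 (Consecutive a b (seq (φ u) (P u v) (φ v)) ⊎
                  Consecutive b a (seq (φ u) (P u v) (φ v))))
    vertices : ∀ w → (∃[ a ] φ a ≡ w) ⊎
               (∃[ u ] ∃[ v ] (FEdge F u v × w ∈ P u v))

Good : ∀ {n} → Graph n → Set
Good {n} G =
  TwoConnected G ×
  (∀ (m : ℕ) (F : Graph m) → edgeCount F < edgeCount G → ¬ SubdivisionOf G F)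

{-# OPTIONS --safe #-}
-- Since x lies on every cycle, G - x is a forest, so a path of G - x is determined by its ends.
-- Saturation then says two things. Adding an edge xv would create a cycle avoiding x, so x is
-- adjacent to every other vertex. Adding the edge joining the ends of a path P of G - x on at
-- least three vertices creates two disjoint cycles: the one avoiding x uses the new edge and so
-- contains P, while the other runs through x and contains an edge of G - x disjoint from P.
-- Walking from that edge to P inside the connected graph G - x and continuing along the longer
-- half of P gives a path of G - x at least two vertices longer than half of P; from three
-- vertices this reaches five, and x with one more disjoint edge gives n ≥ 8. Finally G - x is a
-- tree: orienting its edges towards a root r, and the edges at x away from x except xr, every
-- vertex but x has out-degree 1 and x has out-degree n - 2, so G has 2n - 3 edges.
module Submission where

open import Defs hiding (sym)
open import Data.Bool using (Bool; true; false; T; if_then_else_; _∧_; _∨_)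
open import Data.Bool.Properties using (T-≡; ∧-identityʳ; ∧-zeroʳ; ∧-comm; ∨-comm)
open import Data.Empty using (⊥; ⊥-elim)
open import Data.Fin as Fin using (Fin; zero; suc; toℕ)
open import Data.Fin.Properties using (_≟_; pigeonhole; toℕ-injective)
open import Data.List using (List; []; _∷_; _++_; _∷ʳ_; [_]; length; reverse; map; allFin; lookup; initLast; _∷ʳ′_)
open import Data.List.Membership.Propositional using (_∈_; _∉_)
open import Data.List.Membership.Propositional.Properties
  using (∈-++⁺ˡ; ∈-++⁺ʳ; ∈-++⁻; ∈-∃++; ∈-lookup; ∈-allFin)
open import Data.List.Relation.Unary.Any.Properties using (reverse⁻)
open import Data.List.Properties using (++-assoc; ∷-injectiveˡ; length-++; length-tabulate; unfold-reverse; reverse-++; length-reverse)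
open import Data.List.Relation.Binary.Disjoint.Propositional using (Disjoint)
open import Data.List.Relation.Binary.Subset.Propositional using (_⊆_)
open import Data.List.Relation.Unary.All using (All; []; _∷_)
open import Data.List.Relation.Unary.All.Properties using (¬Any⇒All¬)
open import Data.List.Relation.Unary.AllPairs using ([]; _∷_)
open import Data.List.Relation.Unary.Any using (here; there)
open import Data.List.Relation.Unary.Linked as Linked using (Linked; []; [-]; _∷_)
open import Data.List.Relation.Unary.Unique.Propositional using (Unique)
open import Data.List.Relation.Unary.Unique.Propositional.Properties
  using (Unique[x∷xs]⇒x∉xs; allFin⁺) renaming (++⁺ to Unique-++⁺)
open import Data.Nat using (ℕ; zero; suc; _+_; _*_; _∸_; _≤_; _<_; _<ᵇ_; s≤s; z≤n)
open import Data.Nat.ListAction using (sum)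
open import Data.Nat.Properties using (+-commutativeSemigroup; +-comm; +-assoc; +-suc; +-identityʳ; *-identityʳ; *-zeroʳ; m+n∸n≡m; m+n≡0⇒m≡0; ≤-trans; ≤-reflexive; ≤-total; +-monoˡ-≤; +-monoʳ-≤; m≤m+n; n≤1+n; ≤-refl; m≤n⇒m<n∨m≡n; <-irrefl; *-suc; *-monoʳ-≤; module ≤-Reasoning; _≤?_; ≰⇒>; <-cmp; <ᵇ⇒<; <⇒<ᵇ)
open import Algebra.Properties.CommutativeSemigroup +-commutativeSemigroup using (interchange; xy∙z≈zy∙x)
open import Data.Product using (∃-syntax; _×_; _,_; proj₁; proj₂; uncurry)
open import Data.Sum using (_⊎_; inj₁; inj₂; [_,_]′)
open import Data.Nat.Tactic.RingSolver using (solve-∀)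
open import Relation.Binary.PropositionalEquality
  using (_≡_; _≢_; refl; sym; trans; cong; cong₂; subst; module ≡-Reasoning)
open import Function using (_∘_; Equivalence)
open import Relation.Nullary using (¬_; Dec; yes; no; ⌊_⌋)
open import Relation.Binary.Definitions using (DecidableEquality; tri<; tri≈; tri>)

module _ {A : Set} where

  endpoint : A → List A → A
  endpoint u []       = u
  endpoint u (y ∷ ys) = endpoint y ys

  endpoint-∈ : ∀ u ys → endpoint u ys ∈ u ∷ ys
  endpoint-∈ u []       = here refl
  endpoint-∈ u (y ∷ ys) = there (endpoint-∈ y ys)

  endpoint-++ : ∀ u xs y ys → endpoint u (xs ++ y ∷ ys) ≡ endpoint y ys
  endpoint-++ u []       y ys = refl
  endpoint-++ u (z ∷ xs) y ys = endpoint-++ z xs y ys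

  endpoint-∷ʳ : ∀ u xs y → endpoint u (xs ∷ʳ y) ≡ y
  endpoint-∷ʳ u xs y = endpoint-++ u xs y []

  reverse-∷ʳ : ∀ xs (y : A) → reverse (xs ∷ʳ y) ≡ y ∷ reverse xs
  reverse-∷ʳ xs y = reverse-++ xs [ y ]

  endpoint-reverse : ∀ (w y : A) ys → endpoint w (reverse (y ∷ ys)) ≡ y
  endpoint-reverse w y ys = trans (cong (endpoint w) (unfold-reverse y ys)) (endpoint-∷ʳ w (reverse ys) y)

  Unique-∷ : ∀ {x : A} {xs} → x ∉ xs → Unique xs → Unique (x ∷ xs)
  Unique-∷ {xs = xs} x∉xs u = ¬Any⇒All¬ xs x∉xs ∷ u

  Unique-tail : ∀ {x : A} {xs} → Unique (x ∷ xs) → Unique xs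
  Unique-tail (_ ∷ u) = u

  Unique-++⁻ : ∀ (xs : List A) {ys} → Unique (xs ++ ys) → Unique xs × Unique ys × Disjoint xs ys
  Unique-++⁻ []       u = [] , u , λ ()
  Unique-++⁻ (x ∷ xs) {ys} u with Unique-++⁻ xs (Unique-tail u)
  ... | uxs , uys , dis = Unique-∷ (λ p → x∉ (∈-++⁺ˡ p)) uxs , uys , dis′
    where
    x∉ : x ∉ xs ++ ys
    x∉ = Unique[x∷xs]⇒x∉xs u
    dis′ : Disjoint (x ∷ xs) ys
    dis′ (here refl , q) = x∉ (∈-++⁺ʳ xs q)
    dis′ (there p   , q) = dis (p , q)

  Unique-reverse : ∀ {xs : List A} → Unique xs → Unique (reverse xs)
  Unique-reverse {[]}     u = u
  Unique-reverse {x ∷ xs} u = subst Unique (sym (unfold-reverse x xs))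
    (Unique-++⁺ (Unique-reverse (Unique-tail u)) (Unique-∷ (λ ()) [])
      λ { (p , here refl) → Unique[x∷xs]⇒x∉xs u (reverse⁻ p) })

  Unique-swap : ∀ (xs : List A) {ys} → Unique (xs ++ ys) → Unique (ys ++ xs)
  Unique-swap xs u with Unique-++⁻ xs u
  ... | uxs , uys , dis = Unique-++⁺ uys uxs λ (p , q) → dis (q , p)

  module _ {R : A → A → Set} where

    Linked-++⁻ˡ : ∀ xs {ys} → Linked R (xs ++ ys) → Linked R xs
    Linked-++⁻ˡ []           l       = []
    Linked-++⁻ˡ (x ∷ [])     l       = [-]
    Linked-++⁻ˡ (x ∷ y ∷ xs) (r ∷ l) = r ∷ Linked-++⁻ˡ (y ∷ xs) l

    Linked-++⁻ʳ : ∀ xs {ys} → Linked R (xs ++ ys) → Linked R ys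
    Linked-++⁻ʳ []       l = l
    Linked-++⁻ʳ (x ∷ xs) l = Linked-++⁻ʳ xs (Linked.tail l)

    Linked-join : ∀ y ys {z zs} → Linked R (y ∷ ys) → R (endpoint y ys) z → Linked R (z ∷ zs) →
                  Linked R (y ∷ ys ++ z ∷ zs)
    Linked-join y []       _       r l′ = r ∷ l′
    Linked-join y (w ∷ ys) (r ∷ l) s l′ = r ∷ Linked-join w ys l s l′

    Linked-middle : ∀ y ys {z zs} → Linked R (y ∷ ys ++ z ∷ zs) → R (endpoint y ys) z
    Linked-middle y []       (r ∷ _) = r
    Linked-middle y (w ∷ ys) (_ ∷ l) = Linked-middle w ys l

    Linked-snoc : ∀ xs {y z} → Linked R (xs ∷ʳ y) → R y z → Linked R (xs ∷ʳ y ∷ʳ z)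
    Linked-snoc []           [-]      r = r ∷ [-]
    Linked-snoc (x ∷ [])     (r′ ∷ [-]) r = r′ ∷ r ∷ [-]
    Linked-snoc (x ∷ w ∷ xs) (r′ ∷ l) r = r′ ∷ Linked-snoc (w ∷ xs) l r

    Linked-reverse : (∀ {a b} → R a b → R b a) → ∀ {xs} → Linked R xs → Linked R (reverse xs)
    Linked-reverse sym-R {[]}         l       = []
    Linked-reverse sym-R {x ∷ []}     l       = [-]
    Linked-reverse sym-R {x ∷ y ∷ xs} (r ∷ l) = subst (Linked R) (sym reverse-xyxs)
      (Linked-snoc (reverse xs) (subst (Linked R) (unfold-reverse y xs) (Linked-reverse sym-R l)) (sym-R r))
      where
      reverse-xyxs : reverse (x ∷ y ∷ xs) ≡ reverse xs ∷ʳ y ∷ʳ x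
      reverse-xyxs = trans (unfold-reverse x (y ∷ xs)) (cong (_∷ʳ x) (unfold-reverse y xs))

    Linked-restrict : ∀ {P : A → Set} {S : A → A → Set} → (∀ {a b} → P a → P b → R a b → S a b) →
                      ∀ {xs} → All P xs → Linked R xs → Linked S xs
    Linked-restrict f []             []      = []
    Linked-restrict f (_ ∷ [])       [-]     = [-]
    Linked-restrict f (pa ∷ pb ∷ ps) (r ∷ l) = f pa pb r ∷ Linked-restrict f (pb ∷ ps) l

  endpoint-≢-head : ∀ {h : A} {ys} → Unique (h ∷ ys) → 2 ≤ length (h ∷ ys) → endpoint h ys ≢ h
  endpoint-≢-head {ys = []}     _ (s≤s ())
  endpoint-≢-head {ys = y ∷ ys} u _ eq = Unique[x∷xs]⇒x∉xs u (subst (_∈ y ∷ ys) eq (endpoint-∈ y ys))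

  length-++-∷ : ∀ xs (y : A) ys → 1 ≤ length (xs ++ y ∷ ys)
  length-++-∷ []      y ys = s≤s z≤n
  length-++-∷ (_ ∷ _) y ys = s≤s z≤n

  length-++-∷-swap : ∀ xs (y z : A) ys → length (xs ++ y ∷ ys) ≡ length (ys ++ z ∷ xs)
  length-++-∷-swap xs y z ys = begin
    length (xs ++ y ∷ ys)      ≡⟨ length-++ xs ⟩
    length xs + suc (length ys) ≡⟨ +-suc (length xs) (length ys) ⟩
    suc (length xs + length ys) ≡⟨ cong suc (+-comm (length xs) (length ys)) ⟩
    suc (length ys + length xs) ≡⟨ sym (+-suc (length ys) (length xs)) ⟩
    length ys + suc (length xs) ≡⟨ sym (length-++ ys) ⟩
    length (ys ++ z ∷ xs)      ∎
    where open ≡-Reasoning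

  SimplePath : (A → A → Set) → List A → Set
  SimplePath R xs = Unique xs × Linked R xs

  module _ {R : A → A → Set} where

    SimplePath-++⁻ˡ : ∀ xs {ys} → SimplePath R (xs ++ ys) → SimplePath R xs
    SimplePath-++⁻ˡ xs (u , l) = proj₁ (Unique-++⁻ xs u) , Linked-++⁻ˡ xs l

    SimplePath-++⁻ʳ : ∀ xs {ys} → SimplePath R (xs ++ ys) → SimplePath R ys
    SimplePath-++⁻ʳ xs (u , l) = proj₁ (proj₂ (Unique-++⁻ xs u)) , Linked-++⁻ʳ xs l

    SimplePath-reverse : (∀ {a b} → R a b → R b a) → ∀ {xs} → SimplePath R xs → SimplePath R (reverse xs)
    SimplePath-reverse sym-R (u , l) = Unique-reverse u , Linked-reverse sym-R l

    SimplePath-join : ∀ y ys {z zs} → SimplePath R (y ∷ ys) → SimplePath R (z ∷ zs) →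
                      Disjoint (y ∷ ys) (z ∷ zs) → R (endpoint y ys) z → SimplePath R (y ∷ ys ++ z ∷ zs)
    SimplePath-join y ys (u , l) (u′ , l′) dis r = Unique-++⁺ u u′ dis , Linked-join y ys l r l′

  backward-⊆ : ∀ xs (t : A) ys → t ∷ reverse xs ⊆ xs ++ t ∷ ys
  backward-⊆ xs t ys {v} p =
    subst (v ∈_) (++-assoc xs [ t ] ys) (∈-++⁺ˡ {xs = xs ∷ʳ t} (reverse⁻ (subst (v ∈_) (sym (reverse-∷ʳ xs t)) p)))

  SimplePath-backward : ∀ {R} → (∀ {a b} → R a b → R b a) → ∀ xs {t} ys →
                        SimplePath R (xs ++ t ∷ ys) → SimplePath R (t ∷ reverse xs)
  SimplePath-backward {R} sym-R xs {t} ys S = subst (SimplePath R) (reverse-∷ʳ xs t)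
    (SimplePath-reverse sym-R (SimplePath-++⁻ˡ (xs ∷ʳ t) (subst (SimplePath R) (sym (++-assoc xs [ t ] ys)) S)))

  record Cycle (R : A → A → Set) (c : A) (N : List A) : Set where
    field
      simple : SimplePath R (c ∷ N)
      long   : 2 ≤ length N
      closed : R (endpoint c N) c

  Cycle-rotate : ∀ {R c N z} → Cycle R c N → z ∈ c ∷ N → ∃[ N′ ] Cycle R z N′ × z ∷ N′ ⊆ c ∷ N
  Cycle-rotate {R} {c} {N} {z} C z∈ = rotate (∈-∃++ z∈)
    where
    open Cycle C
    rotate : (∃[ α ] ∃[ β ] c ∷ N ≡ α ++ [ z ] ++ β) → ∃[ N′ ] Cycle R z N′ × z ∷ N′ ⊆ c ∷ N
    rotate ([]      , β , refl) = N , C , λ p → p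
    rotate (_ ∷ α′ , β , refl) = β ++ c ∷ α′ , record
        { simple = Unique-swap (c ∷ α′) (proj₁ simple) , linked
        ; long   = subst (2 ≤_) (length-++-∷-swap α′ z c β) long
        ; closed = subst (λ w → R w z) (sym (endpoint-++ z β c α′)) (Linked-middle c α′ (proj₂ simple))
        } , λ {v} p → swap-∈ v p
      where
      linked : Linked R (z ∷ β ++ c ∷ α′)
      linked = Linked-join z β (Linked-++⁻ʳ (c ∷ α′) (proj₂ simple))
                 (subst (λ w → R w c) (endpoint-++ c α′ z β) closed)
                 (Linked-++⁻ˡ (c ∷ α′) (proj₂ simple))
      swap-∈ : ∀ v → v ∈ z ∷ β ++ c ∷ α′ → v ∈ c ∷ α′ ++ z ∷ β
      swap-∈ v p with ∈-++⁻ (z ∷ β) p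
      ... | inj₁ q = ∈-++⁺ʳ (c ∷ α′) q
      ... | inj₂ q = ∈-++⁺ˡ q

  Cycle-reverse : ∀ {R : A → A → Set} → (∀ {a b} → R a b → R b a) →
                  ∀ {c N} → Cycle R c N → Cycle R c (reverse N)
  Cycle-reverse sym-R {c} {N} C with initLast N
  Cycle-reverse sym-R C | [] with () ← Cycle.long C
  Cycle-reverse sym-R C | [] ∷ʳ′ w with s≤s () ← Cycle.long C
  Cycle-reverse {R = R} sym-R {c} C | (m ∷ ms) ∷ʳ′ w = subst (Cycle R c) (sym (reverse-∷ʳ (m ∷ ms) w)) record
    { simple = Unique-∷ (Unique[x∷xs]⇒x∉xs u ∘ reverse⁻ ∘ subst (c ∈_) (sym (reverse-∷ʳ (m ∷ ms) w)))
                        (subst Unique (reverse-∷ʳ (m ∷ ms) w) (Unique-reverse (Unique-tail u)))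
             , sym-R (subst (λ v → R v c) (endpoint-∷ʳ m ms w) closed)
               ∷ subst (Linked R) (reverse-∷ʳ (m ∷ ms) w) (Linked-reverse sym-R (Linked.tail l))
    ; long   = s≤s (subst (1 ≤_) (sym (length-reverse (m ∷ ms))) (s≤s z≤n))
    ; closed = subst (λ v → R v c) (sym (endpoint-reverse w m ms)) (sym-R (Linked.head l))
    }
    where
    open Cycle C
    u : Unique (c ∷ (m ∷ ms) ∷ʳ w)
    u = proj₁ simple
    l : Linked R (c ∷ (m ∷ ms) ∷ʳ w)
    l = proj₂ simple

  module _ (_≟ₐ_ : DecidableEquality A) where
    open import Data.List.Membership.DecPropositional _≟ₐ_ using (_∈?_)

    firstCommon : ∀ xs ys {z} → z ∈ xs → z ∈ ys →
                  ∃[ α ] ∃[ w ] ∃[ β ] xs ≡ α ++ w ∷ β × w ∈ ys × Disjoint α ys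
    firstCommon (x ∷ xs) ys z∈xs z∈ys with x ∈? ys
    ... | yes x∈ys = [] , x , xs , refl , x∈ys , λ ()
    firstCommon (x ∷ xs) ys (here refl) z∈ys | no x∉ys = ⊥-elim (x∉ys z∈ys)
    firstCommon (x ∷ xs) ys (there z∈xs) z∈ys | no x∉ys with firstCommon xs ys z∈xs z∈ys
    ... | α , w , β , refl , w∈ys , dis = x ∷ α , w , β , refl , w∈ys , λ
      { (here refl , q) → x∉ys q
      ; (there p , q)   → dis (p , q) }

Unique-length≤ : ∀ {n} {xs : List (Fin n)} → Unique xs → length xs ≤ n
Unique-length≤ {n} {xs} u with length xs ≤? n
... | yes le = le
... | no  gt with pigeonhole (≰⇒> gt) (lookup xs)
...   | i , j , i<j , eq = ⊥-elim (lookup-injective u i j i<j eq)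
  where
  lookup-injective : ∀ {ys : List (Fin n)} → Unique ys → ∀ i j → i Fin.< j → lookup ys i ≢ lookup ys j
  lookup-injective {y ∷ ys} u zero    (suc j) _         eq = Unique[x∷xs]⇒x∉xs u (subst (_∈ ys) (sym eq) (∈-lookup j))
  lookup-injective {y ∷ ys} u (suc i) (suc j) (s≤s i<j) eq = lookup-injective (Unique-tail u) i j i<j eq

∑[_]_ : {D : Set} → List D → (D → ℕ) → ℕ
∑[ L ] f = sum (map f L)

module _ {D : Set} where

  ∑-cong : ∀ (L : List D) {f g : D → ℕ} → (∀ i → f i ≡ g i) → ∑[ L ] f ≡ ∑[ L ] g
  ∑-cong []      eq = refl
  ∑-cong (i ∷ L) eq = cong₂ _+_ (eq i) (∑-cong L eq)

  ∑-+ : ∀ (L : List D) (f g : D → ℕ) → ∑[ L ] (λ i → f i + g i) ≡ ∑[ L ] f + ∑[ L ] g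
  ∑-+ []      f g = refl
  ∑-+ (i ∷ L) f g = begin
    f i + g i + ∑[ L ] (λ j → f j + g j) ≡⟨ cong (f i + g i +_) (∑-+ L f g) ⟩
    f i + g i + (∑[ L ] f + ∑[ L ] g)     ≡⟨ interchange (f i) (g i) (∑[ L ] f) (∑[ L ] g) ⟩
    f i + ∑[ L ] f + (g i + ∑[ L ] g)     ∎
    where open ≡-Reasoning

  ∑-const : ∀ (L : List D) k → ∑[ L ] (λ _ → k) ≡ length L * k
  ∑-const []      k = refl
  ∑-const (i ∷ L) k = cong (k +_) (∑-const L k)

  ∑-except : (_≟ᴰ_ : DecidableEquality D) → ∀ {L d} (f g : D → ℕ) → Unique L → d ∈ L →
             (∀ i → i ≢ d → f i ≡ g i) → ∑[ L ] f + g d ≡ ∑[ L ] g + f d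
  ∑-except _≟ᴰ_ {i ∷ L} {d} f g u d∈ agree with i ≟ᴰ d
  ... | yes refl = begin
    f i + ∑[ L ] f + g i ≡⟨ xy∙z≈zy∙x (f i) (∑[ L ] f) (g i) ⟩
    g i + ∑[ L ] f + f i ≡⟨ cong (λ s → g i + s + f i) (∑-cong-∉ L (Unique[x∷xs]⇒x∉xs u)) ⟩
    g i + ∑[ L ] g + f i ∎
    where
    open ≡-Reasoning
    ∑-cong-∉ : ∀ L′ → i ∉ L′ → ∑[ L′ ] f ≡ ∑[ L′ ] g
    ∑-cong-∉ []       _   = refl
    ∑-cong-∉ (j ∷ L′) i∉ = cong₂ _+_ (agree j (λ j≡i → i∉ (here (sym j≡i)))) (∑-cong-∉ L′ (i∉ ∘ there))
  ... | no i≢d with d∈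
  ...   | here d≡i  = ⊥-elim (i≢d (sym d≡i))
  ...   | there d∈L = begin
    f i + ∑[ L ] f + g d   ≡⟨ +-assoc (f i) (∑[ L ] f) (g d) ⟩
    f i + (∑[ L ] f + g d) ≡⟨ cong₂ _+_ (agree i i≢d) (∑-except _≟ᴰ_ f g (Unique-tail u) d∈L agree) ⟩
    g i + (∑[ L ] g + f d) ≡⟨ sym (+-assoc (g i) (∑[ L ] g) (f d)) ⟩
    g i + ∑[ L ] g + f d   ∎
    where open ≡-Reasoning

∑-allFin-const : ∀ n k → ∑[ allFin n ] (λ _ → k) ≡ n * k
∑-allFin-const n k = trans (∑-const (allFin n) k) (cong (_* k) (length-tabulate {n = n} (λ (i : Fin n) → i)))

∑-comm : ∀ {D E : Set} (L : List D) (K : List E) (f : D → E → ℕ) →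
         ∑[ L ] (λ i → ∑[ K ] (f i)) ≡ ∑[ K ] (λ j → ∑[ L ] (λ i → f i j))
∑-comm []      K f = sym (trans (∑-const K 0) (*-zeroʳ (length K)))
∑-comm (i ∷ L) K f = trans (cong (∑[ K ] (f i) +_) (∑-comm L K f))
                           (sym (∑-+ K (f i) (λ j → ∑[ L ] (λ i′ → f i′ j))))

𝟙 : Bool → ℕ
𝟙 b = if b then 1 else 0

𝟙-yes : ∀ {P : Set} (p? : Dec P) → P → 𝟙 ⌊ p? ⌋ ≡ 1
𝟙-yes (yes _) _ = refl
𝟙-yes (no ¬p) p = ⊥-elim (¬p p)

𝟙-no : ∀ {P : Set} (p? : Dec P) → ¬ P → 𝟙 ⌊ p? ⌋ ≡ 0
𝟙-no (yes p) ¬p = ⊥-elim (¬p p)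
𝟙-no (no _)  _  = refl

<ᵇ-true : ∀ {m n} → m < n → (m <ᵇ n) ≡ true
<ᵇ-true m<n = Equivalence.to T-≡ (<⇒<ᵇ m<n)

<ᵇ-false : ∀ {m n} → ¬ m < n → (m <ᵇ n) ≡ false
<ᵇ-false {m} {n} m≮n with m <ᵇ n in eq
... | true  = ⊥-elim (m≮n (<ᵇ⇒< m n (subst T (sym eq) _)))
... | false = refl

edgeCount-orientation : ∀ {n} (G : Graph n) (g : Fin n → Fin n → ℕ) →
                        (∀ i j → g i j + g j i ≡ 𝟙 (adj G i j)) →
                        edgeCount G ≡ ∑[ allFin n ] (λ i → ∑[ allFin n ] (g i))
edgeCount-orientation {n} G g orient = begin
  edgeCount G
    ≡⟨ ∑-cong F (λ i → ∑-cong F (split i)) ⟩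
  ∑[ F ] (λ i → ∑[ F ] (λ j → g< i j + g<ᵀ i j))
    ≡⟨ ∑-cong F (λ i → ∑-+ F (g< i) (g<ᵀ i)) ⟩
  ∑[ F ] (λ i → ∑[ F ] (g< i) + ∑[ F ] (g<ᵀ i))
    ≡⟨ ∑-+ F (λ i → ∑[ F ] (g< i)) (λ i → ∑[ F ] (g<ᵀ i)) ⟩
  ∑[ F ] (λ i → ∑[ F ] (g< i)) + ∑[ F ] (λ i → ∑[ F ] (g<ᵀ i))
    ≡⟨ cong (∑[ F ] (λ i → ∑[ F ] (g< i)) +_) (∑-comm F F g<ᵀ) ⟩
  ∑[ F ] (λ i → ∑[ F ] (g< i)) + ∑[ F ] (λ i → ∑[ F ] (λ j → g> i j))
    ≡⟨ sym (∑-+ F (λ i → ∑[ F ] (g< i)) (λ i → ∑[ F ] (g> i))) ⟩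
  ∑[ F ] (λ i → ∑[ F ] (g< i) + ∑[ F ] (g> i))
    ≡⟨ ∑-cong F (λ i → sym (∑-+ F (g< i) (g> i))) ⟩
  ∑[ F ] (λ i → ∑[ F ] (λ j → g< i j + g> i j))
    ≡⟨ ∑-cong F (λ i → ∑-cong F (merge i)) ⟩
  ∑[ F ] (λ i → ∑[ F ] (g i)) ∎
  where
  open ≡-Reasoning
  F : List (Fin n)
  F = allFin n
  lt : Fin n → Fin n → Bool
  lt i j = toℕ i <ᵇ toℕ j
  g< g<ᵀ g> : Fin n → Fin n → ℕ
  g< i j = if lt i j then g i j else 0
  g<ᵀ i j = if lt i j then g j i else 0
  g> i j = if lt j i then g i j else 0

  split : ∀ i j → 𝟙 (adj G i j ∧ lt i j) ≡ g< i j + g<ᵀ i j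
  split i j with lt i j
  ... | true  = trans (cong 𝟙 (∧-identityʳ (adj G i j))) (sym (orient i j))
  ... | false = cong 𝟙 (∧-zeroʳ (adj G i j))

  merge : ∀ i j → g< i j + g> i j ≡ g i j
  merge i j with <-cmp (toℕ i) (toℕ j)
  ... | tri< i<j _ j≮i rewrite <ᵇ-true i<j | <ᵇ-false j≮i = +-identityʳ (g i j)
  ... | tri> i≮j _ j<i rewrite <ᵇ-false i≮j | <ᵇ-true j<i = refl
  ... | tri≈ i≮j i≡j j≮i rewrite <ᵇ-false i≮j | <ᵇ-false j≮i | toℕ-injective i≡j =
        sym (m+n≡0⇒m≡0 (g j j) (trans (orient j j) (cong 𝟙 (irrefl G j))))

longer-of-two : ∀ {m a b} → m ≤ a + b → m ≤ 2 * a ⊎ m ≤ 2 * b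
longer-of-two {m} {a} {b} m≤a+b with ≤-total a b
... | inj₁ a≤b = inj₂ (≤-trans m≤a+b (≤-trans (+-monoˡ-≤ b a≤b) (≤-reflexive (cong (b +_) (sym (+-identityʳ b))))))
... | inj₂ b≤a = inj₁ (≤-trans m≤a+b (≤-trans (+-monoʳ-≤ a b≤a) (≤-reflexive (cong (a +_) (sym (+-identityʳ a))))))

halves-bound : ∀ {k l₁ l₂} → 1 ≤ k → 3 + (l₁ + suc l₂) ≤ (k + suc l₂) + (k + suc l₁)
halves-bound {suc k} {l₁} {l₂} _ = ≤-trans (m≤m+n _ (k + k)) (≤-reflexive (sym (rearrange k l₁ l₂)))
  where
  rearrange : ∀ k l₁ l₂ → suc (k + suc l₂) + suc (k + suc l₁) ≡ 3 + (l₁ + suc l₂) + (k + k)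
  rearrange = solve-∀

2*-cancel-≤ : ∀ {k l} → 2 * k ≤ suc (2 * l) → k ≤ l
2*-cancel-≤ {k} {l} 2k≤1+2l with ≤-total k l
... | inj₁ k≤l = k≤l
... | inj₂ l≤k with m≤n⇒m<n∨m≡n l≤k
...   | inj₂ refl = ≤-refl
...   | inj₁ l<k  = ⊥-elim (<-irrefl refl (≤-trans (≤-trans (≤-reflexive (sym (*-suc 2 l))) (*-monoʳ-≤ 2 l<k)) 2k≤1+2l))

three-others : ∀ {n} (x : Fin n) → 4 ≤ n →
               ∃[ p ] ∃[ q ] ∃[ r ] p ≢ x × q ≢ x × r ≢ x × p ≢ q × p ≢ r × q ≢ r
three-others {suc zero}                   _ (s≤s ())
three-others {suc (suc zero)}             _ (s≤s (s≤s ()))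
three-others {suc (suc (suc zero))}       _ (s≤s (s≤s (s≤s ())))
three-others {suc (suc (suc (suc _)))} zero _ =
  suc zero , suc (suc zero) , suc (suc (suc zero)) , (λ ()) , (λ ()) , (λ ()) , (λ ()) , (λ ()) , (λ ())
three-others {suc (suc (suc (suc _)))} (suc zero) _ =
  zero , suc (suc zero) , suc (suc (suc zero)) , (λ ()) , (λ ()) , (λ ()) , (λ ()) , (λ ()) , (λ ())
three-others {suc (suc (suc (suc _)))} (suc (suc zero)) _ =
  zero , suc zero , suc (suc (suc zero)) , (λ ()) , (λ ()) , (λ ()) , (λ ()) , (λ ()) , (λ ())
three-others {suc (suc (suc (suc _)))} (suc (suc (suc _))) _ =
  zero , suc zero , suc (suc zero) , (λ ()) , (λ ()) , (λ ()) , (λ ()) , (λ ()) , (λ ())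

m+n≡o⇒m≡o∸n : ∀ {m n o} → m + n ≡ o → m ≡ o ∸ n
m+n≡o⇒m≡o∸n {m} {n} m+n≡o = trans (sym (m+n∸n≡m m n)) (cong (_∸ n) m+n≡o)

Adj-sym : ∀ {n} (G : Graph n) {a b} → E (adj G) a b → E (adj G) b a
Adj-sym G {a} {b} = subst T (Graph.sym G a b)

IsCycle⇒Cycle : ∀ {n} {B : AdjFn n} {u ms w} → IsCycle B u ms w → Cycle (E B) u (ms ∷ʳ w)
IsCycle⇒Cycle {B = B} {u} {ms} {w} (simple , 1≤ms , closed) = record
  { simple = simple
  ; long   = subst (2 ≤_) (sym (trans (length-++ ms) (+-comm (length ms) 1))) (s≤s 1≤ms)
  ; closed = subst (λ v → E B v u) (sym (endpoint-∷ʳ u ms w)) closed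
  }

module Forest {n} (G : Graph n) (x : Fin n)
  (x∈cycles : ∀ u ms w → IsCycle (adj G) u ms w → x ∈ seq u ms w) where

  Adj : Fin n → Fin n → Set
  Adj = E (adj G)

  record XPath (u : Fin n) (M : List (Fin n)) : Set where
    field
      simple : SimplePath Adj (u ∷ M)
      avoids : x ∉ u ∷ M

  XPath-tail : ∀ {u a M} → XPath u (a ∷ M) → XPath a M
  XPath-tail P = record { simple = Unique-tail (proj₁ simple) , Linked.tail (proj₂ simple) ; avoids = avoids ∘ there }
    where open XPath P

  XPath-[] : ∀ {v} → v ≢ x → XPath v []
  XPath-[] v≢x = record { simple = Unique-∷ (λ ()) [] , [-] ; avoids = λ { (here x≡v) → v≢x (sym x≡v) } }

  XPath-prefix : ∀ {u} xs {ys} → XPath u (xs ++ ys) → XPath u xs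
  XPath-prefix xs P = record { simple = SimplePath-++⁻ˡ (_ ∷ xs) (XPath.simple P) ; avoids = XPath.avoids P ∘ ∈-++⁺ˡ }

  Cycle⇒x∈ : ∀ {c N} → Cycle Adj c N → x ∈ c ∷ N
  Cycle⇒x∈ {c} {N} C with initLast N
  Cycle⇒x∈ C | [] with () ← Cycle.long C
  Cycle⇒x∈ C | [] ∷ʳ′ w with s≤s () ← Cycle.long C
  Cycle⇒x∈ {c} C | (m ∷ ms) ∷ʳ′ w =
    x∈cycles c (m ∷ ms) w (simple , s≤s z≤n , subst (λ v → Adj v c) (endpoint-∷ʳ c (m ∷ ms) w) closed)
    where open Cycle C

  XPath-unclosable : ∀ {u M} → XPath u M → 2 ≤ length M → ¬ Adj (endpoint u M) u
  XPath-unclosable P long closed = XPath.avoids P (Cycle⇒x∈ record { simple = XPath.simple P ; long = long ; closed = closed })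

  -- Follow the first branch up to its first vertex w on the second one, then return along the
  -- second branch: this closes a cycle through u avoiding x.
  XPath-branches : ∀ {u a b M M′} → a ≢ b → XPath u (a ∷ M) → XPath u (b ∷ M′) → endpoint a M ≢ endpoint b M′
  XPath-branches {u} {a} {b} {M} {M′} a≢b P Q same
    with firstCommon _≟_ (a ∷ M) (b ∷ M′) (endpoint-∈ a M) (subst (_∈ b ∷ M′) (sym same) (endpoint-∈ b M′))
  ... | α , w , β , eqP , w∈Q , α∩Q with ∈-∃++ w∈Q
  ... | γ , δ , eqQ = XPath.avoids P (cycle-⊆ (Cycle⇒x∈ cycle))
    where
    open XPath
    eqP′ : u ∷ a ∷ M ≡ (u ∷ α) ++ w ∷ β
    eqP′ = cong (u ∷_) eqP

    forth : SimplePath Adj (u ∷ α)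
    forth = SimplePath-++⁻ˡ (u ∷ α) (subst (SimplePath Adj) eqP′ (simple P))
    back : SimplePath Adj (w ∷ reverse γ)
    back = SimplePath-backward (Adj-sym G) γ δ (subst (SimplePath Adj) eqQ (XPath.simple (XPath-tail Q)))

    back-⊆ : w ∷ reverse γ ⊆ b ∷ M′
    back-⊆ {v} p = subst (v ∈_) (sym eqQ) (backward-⊆ γ w δ p)
    back-to-b : ∀ γ′ → b ∷ M′ ≡ γ′ ++ [ w ] ++ δ → endpoint w (reverse γ′) ≡ b
    back-to-b []       eq = sym (∷-injectiveˡ eq)
    back-to-b (c ∷ γ′) eq = trans (endpoint-reverse w c γ′) (sym (∷-injectiveˡ eq))

    cycle-⊆ : x ∈ u ∷ α ++ w ∷ reverse γ → x ∈ u ∷ a ∷ M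
    cycle-⊆ p with ∈-++⁻ (u ∷ α) p
    ... | inj₁ q = subst (x ∈_) (sym eqP′) (∈-++⁺ˡ q)
    ... | inj₂ q = ⊥-elim (avoids Q (there (back-⊆ q)))

    long-enough : ∀ α′ γ′ → (α′ ≡ [] → γ′ ≡ [] → ⊥) → 2 ≤ length (α′ ++ w ∷ reverse γ′)
    long-enough (_ ∷ α′) γ′ _  = s≤s (length-++-∷ α′ w (reverse γ′))
    long-enough [] []        ne = ⊥-elim (ne refl refl)
    long-enough [] (c ∷ γ′)  _  = s≤s (subst (1 ≤_) (sym (length-reverse (c ∷ γ′))) (s≤s z≤n))

    cycle : Cycle Adj u (α ++ w ∷ reverse γ)
    cycle = record
      { simple = SimplePath-join u α forth back disjoint (Linked-middle u α (subst (Linked Adj) eqP′ (proj₂ (simple P))))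
      ; long   = long-enough α γ λ { refl refl → a≢b (trans (∷-injectiveˡ eqP) (sym (∷-injectiveˡ eqQ))) }
      ; closed = subst (λ v → Adj v u) (sym (trans (endpoint-++ u α w (reverse γ)) (back-to-b γ eqQ)))
                   (Adj-sym G (Linked.head (proj₂ (simple Q))))
      }
      where
      disjoint : Disjoint (u ∷ α) (w ∷ reverse γ)
      disjoint (here refl , q) = Unique[x∷xs]⇒x∉xs (proj₁ (simple Q)) (back-⊆ q)
      disjoint (there p   , q) = α∩Q (p , back-⊆ q)

  XPath-unique : ∀ {u M M′} → XPath u M → XPath u M′ → endpoint u M ≡ endpoint u M′ → M ≡ M′
  XPath-unique {M = []}    {[]}     P Q same = refl
  XPath-unique {M = []}    {b ∷ M′} P Q same =
    ⊥-elim (Unique[x∷xs]⇒x∉xs (proj₁ (XPath.simple Q)) (subst (_∈ b ∷ M′) (sym same) (endpoint-∈ b M′)))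
  XPath-unique {M = a ∷ M} {[]}     P Q same =
    ⊥-elim (Unique[x∷xs]⇒x∉xs (proj₁ (XPath.simple P)) (subst (_∈ a ∷ M) same (endpoint-∈ a M)))
  XPath-unique {M = a ∷ M} {b ∷ M′} P Q same with a ≟ b
  ... | yes refl = cong (a ∷_) (XPath-unique (XPath-tail P) (XPath-tail Q) same)
  ... | no  a≢b  = ⊥-elim (XPath-branches a≢b P Q same)

  XPath-ends-≢ : ∀ {u M} → XPath u M → 2 ≤ length M → u ≢ endpoint u M
  XPath-ends-≢ P long = endpoint-≢-head (proj₁ (XPath.simple P)) (≤-trans long (n≤1+n _)) ∘ sym

  true⇒Adj : ∀ {p q} → adj G p q ≡ true → Adj p q
  true⇒Adj eq = subst T (sym eq) _

  XPath-ends-non-adjacent : ∀ {u M} → XPath u M → 2 ≤ length M → adj G u (endpoint u M) ≡ false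
  XPath-ends-non-adjacent {u} {M} P long with adj G u (endpoint u M) in adjacent
  ... | true  = ⊥-elim (XPath-unclosable P long (Adj-sym G (true⇒Adj adjacent)))
  ... | false = refl

  module AddEdge (u v : Fin n) where

    Adj⁺ : Fin n → Fin n → Set
    Adj⁺ = E (addEdge (adj G) u v)

    Adj⁺-sym : ∀ {p q} → Adj⁺ p q → Adj⁺ q p
    Adj⁺-sym {p} {q} = subst T (cong₂ _∨_ (Graph.sym G p q)
      (trans (∨-comm (⌊ p ≟ u ⌋ ∧ ⌊ q ≟ v ⌋) _) (cong₂ _∨_ (∧-comm ⌊ p ≟ v ⌋ _) (∧-comm ⌊ p ≟ u ⌋ _))))

    Adj⁺⇒Adj : ∀ {p q} → u ≢ p → u ≢ q → Adj⁺ p q → Adj p q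
    Adj⁺⇒Adj {p} {q} u≢p u≢q e with adj G p q | p ≟ u | q ≟ u | p ≟ v
    ... | true  | _        | _        | _     = _
    ... | false | yes refl | _        | _     = ⊥-elim (u≢p refl)
    ... | false | no _     | yes refl | _     = ⊥-elim (u≢q refl)
    ... | false | no _     | no _     | yes _ = e
    ... | false | no _     | no _     | no _  = e

    Adj⁺-new : ∀ {p q} → Adj⁺ p q → adj G p q ≡ false → (p ≡ u × q ≡ v) ⊎ (p ≡ v × q ≡ u)
    Adj⁺-new {p} {q} e old with adj G p q | p ≟ u | q ≟ v | p ≟ v | q ≟ u
    Adj⁺-new e  refl | false | yes p≡u | yes q≡v | _       | _       = inj₁ (p≡u , q≡v)
    Adj⁺-new e  refl | false | _       | _       | yes p≡v | yes q≡u = inj₂ (p≡v , q≡u)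
    Adj⁺-new () refl | false | no _    | _       | no _    | _
    Adj⁺-new () refl | false | no _    | _       | yes _   | no _
    Adj⁺-new () refl | false | yes _   | no _    | no _    | _
    Adj⁺-new () refl | false | yes _   | no _    | yes _   | no _

    Linked⁺⇒Linked : ∀ {L} → u ∉ L → Linked Adj⁺ L → Linked Adj L
    Linked⁺⇒Linked {L} u∉L = Linked-restrict (λ u≢p u≢q → Adj⁺⇒Adj u≢p u≢q) (¬Any⇒All¬ L u∉L)

    Cycle⁺-avoiding-u : ∀ {c N} → Cycle Adj⁺ c N → u ∉ c ∷ N → Cycle Adj c N
    Cycle⁺-avoiding-u {c} {N} C u∉ = record
      { simple = proj₁ simple , Linked⁺⇒Linked u∉ (proj₂ simple)
      ; long   = long
      ; closed = Adj⁺⇒Adj (λ { refl → u∉ (endpoint-∈ c N) }) (λ { refl → u∉ (here refl) }) closed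
      }
      where open Cycle C

    module _ (u≢v : u ≢ v) where

      closing-new⇒XPath : ∀ {N} → Cycle Adj⁺ u N → x ∉ u ∷ N → adj G (endpoint u N) u ≡ false →
                          XPath u N × endpoint u N ≡ v
      closing-new⇒XPath {[]}     C _ _ with () ← Cycle.long C
      closing-new⇒XPath {h ∷ N₀} C x∉ closing-old = record
          { simple = proj₁ simple , first ∷ Linked⁺⇒Linked u∉ (Linked.tail (proj₂ simple))
          ; avoids = x∉ }
        , end≡v
        where
        open Cycle C
        u∉ : u ∉ h ∷ N₀
        u∉ = Unique[x∷xs]⇒x∉xs (proj₁ simple)
        end≡v : endpoint h N₀ ≡ v
        end≡v with Adj⁺-new closed closing-old
        ... | inj₁ (_ , u≡v) = ⊥-elim (u≢v u≡v)
        ... | inj₂ (e≡v , _) = e≡v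
        first : Adj u h
        first with adj G u h in first-old
        ... | true  = _
        ... | false with Adj⁺-new (Linked.head (proj₂ simple)) first-old
        ...   | inj₁ (_ , h≡v) = ⊥-elim (endpoint-≢-head (Unique-tail (proj₁ simple)) long (trans end≡v (sym h≡v)))
        ...   | inj₂ (u≡v , _) = ⊥-elim (u≢v u≡v)

      -- Exactly one of the two edges of the cycle at u is the new edge uv; reversing the cycle if
      -- necessary, it is the closing edge.
      Cycle⁺⇒XPath : ∀ {N} → Cycle Adj⁺ u N → x ∉ u ∷ N → ∃[ M ] (XPath u M × endpoint u M ≡ v) × u ∷ M ⊆ u ∷ N
      Cycle⁺⇒XPath {[]}     C _  with () ← Cycle.long C
      Cycle⁺⇒XPath {h ∷ N₀} C x∉ with adj G (endpoint h N₀) u in closing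
      ... | false = h ∷ N₀ , closing-new⇒XPath C x∉ closing , λ p → p
      ... | true with adj G u h in first
      ...   | true  = ⊥-elim (x∉ (Cycle⇒x∈ (record
                        { simple = proj₁ simple , true⇒Adj first ∷ Linked⁺⇒Linked u∉ (Linked.tail (proj₂ simple))
                        ; long   = long
                        ; closed = true⇒Adj closing })))
        where
        open Cycle C
        u∉ : u ∉ h ∷ N₀
        u∉ = Unique[x∷xs]⇒x∉xs (proj₁ simple)
      ...   | false = reverse (h ∷ N₀) , closing-new⇒XPath (Cycle-reverse Adj⁺-sym C) (x∉ ∘ ∷-reverse⁻)
                        (trans (cong (λ w → adj G w u) (endpoint-reverse u h N₀)) (trans (Graph.sym G h u) first))
                    , ∷-reverse⁻
        where
        ∷-reverse⁻ : u ∷ reverse (h ∷ N₀) ⊆ u ∷ h ∷ N₀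
        ∷-reverse⁻ (here p)  = here p
        ∷-reverse⁻ (there p) = there (reverse⁻ p)

module Saturation {n} (G : Graph n) (x : Fin n)
  (x∈cycles : ∀ u ms w → IsCycle (adj G) u ms w → x ∈ seq u ms w)
  (saturated : ∀ u v → u ≢ v → adj G u v ≡ false → TwoDisjointCycles (addEdge (adj G) u v))
  (connected : ConnectedMinus G x) where

  open Forest G x x∈cycles
  open import Data.List.Membership.DecPropositional (_≟_ {n}) using (_∈?_)

  x-free-cycle : ∀ {B} → TwoDisjointCycles B →
                 ∃[ c₁ ] ∃[ N₁ ] ∃[ c₂ ] ∃[ N₂ ] Cycle (E B) c₁ N₁ × Cycle (E B) c₂ N₂ ×
                   Disjoint (c₁ ∷ N₁) (c₂ ∷ N₂) × x ∉ c₁ ∷ N₁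
  x-free-cycle (u₁ , ms₁ , w₁ , u₂ , ms₂ , w₂ , C₁ , C₂ , dis) with x ∈? seq u₁ ms₁ w₁
  ... | no  x∉C₁ = u₁ , ms₁ ∷ʳ w₁ , u₂ , ms₂ ∷ʳ w₂ , IsCycle⇒Cycle C₁ , IsCycle⇒Cycle C₂ ,
                   (λ (p , q) → dis _ p q) , x∉C₁
  ... | yes x∈C₁ = u₂ , ms₂ ∷ʳ w₂ , u₁ , ms₁ ∷ʳ w₁ , IsCycle⇒Cycle C₂ , IsCycle⇒Cycle C₁ ,
                   (λ (p , q) → dis _ q p) , dis x x∈C₁

  x-adjacent : ∀ v → x ≢ v → adj G x v ≡ true
  x-adjacent v x≢v with adj G x v in non-adjacent
  ... | true  = refl
  ... | false with x-free-cycle (saturated x v x≢v non-adjacent)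
  ...   | _ , _ , _ , _ , C₁ , _ , _ , x∉C₁ = ⊥-elim (x∉C₁ (Cycle⇒x∈ (AddEdge.Cycle⁺-avoiding-u x v C₁ x∉C₁)))

  EdgeOff : List (Fin n) → Set
  EdgeOff L = ∃[ a ] ∃[ b ] Adj a b × a ∉ L × b ∉ L

  -- Saturation applied to the two ends of the path: the new cycle through uv closes up this very path,
  -- so the other cycle passes through x and has an edge of G - x disjoint from it.
  edge-off-path : ∀ {u M} → XPath u M → 2 ≤ length M → EdgeOff (x ∷ u ∷ M)
  edge-off-path {u} {M} P long with x-free-cycle (saturated u _ (XPath-ends-≢ P long) (XPath-ends-non-adjacent P long))
  ... | c₁ , N₁ , c₂ , N₂ , C₁ , C₂ , dis , x∉C₁ = uncurry edge-after-x (proj₂ (Cycle-rotate C₂′ (Cycle⇒x∈ C₂′)))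
    where
    open AddEdge u (endpoint u M)

    u∈C₁ : u ∈ c₁ ∷ N₁
    u∈C₁ with u ∈? c₁ ∷ N₁
    ... | yes u∈ = u∈
    ... | no  u∉ = ⊥-elim (x∉C₁ (Cycle⇒x∈ (Cycle⁺-avoiding-u C₁ u∉)))

    P⊆C₁ : u ∷ M ⊆ c₁ ∷ N₁
    P⊆C₁ with Cycle-rotate C₁ u∈C₁
    ... | N , C , ⊆₁ with Cycle⁺⇒XPath (XPath-ends-≢ P long) C (x∉C₁ ∘ ⊆₁)
    ...   | M′ , (P′ , end) , ⊆′ = ⊆₁ ∘ ⊆′ ∘ subst (λ L → _ ∈ u ∷ L) (XPath-unique P P′ (sym end))

    C₂′ : Cycle Adj c₂ N₂
    C₂′ = Cycle⁺-avoiding-u C₂ (λ u∈C₂ → dis (u∈C₁ , u∈C₂))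

    edge-after-x : ∀ {N} → Cycle Adj x N → x ∷ N ⊆ c₂ ∷ N₂ → EdgeOff (x ∷ u ∷ M)
    edge-after-x {[]}         C _ with () ← Cycle.long C
    edge-after-x {_ ∷ []}     C _ with s≤s () ← Cycle.long C
    edge-after-x {a ∷ b ∷ N} C ⊆ = a , b , Linked.head (Linked.tail (proj₂ simple))
      , off (here refl) (there (here refl)) , off (there (here refl)) (there (there (here refl)))
      where
      open Cycle C
      off : ∀ {v} → v ∈ a ∷ b ∷ N → v ∈ x ∷ a ∷ b ∷ N → v ∉ x ∷ u ∷ M
      off v∈ v∈C (here refl) = Unique[x∷xs]⇒x∉xs (proj₁ simple) v∈
      off v∈ v∈C (there v∈P) = dis (P⊆C₁ v∈P , ⊆ v∈C)

  connect : ∀ p q → p ≢ x → q ≢ x → p ≡ q ⊎ ∃[ M ] XPath p M × endpoint p M ≡ q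
  connect p q p≢x q≢x with connected p q p≢x q≢x
  ... | inj₁ p≡q = inj₁ p≡q
  ... | inj₂ (ms , simple , x∉ms) = inj₂ (ms ∷ʳ q , record { simple = simple ; avoids = avoids } , endpoint-∷ʳ p ms q)
    where
    avoids : x ∉ p ∷ ms ∷ʳ q
    avoids (here x≡p)  = p≢x (sym x≡p)
    avoids (there x∈) with ∈-++⁻ ms x∈
    ... | inj₁ x∈ms       = x∉ms x∈ms
    ... | inj₂ (here x≡q) = q≢x (sym x≡q)

  record Approach (L : List (Fin n)) : Set where
    field
      {y}      : Fin n
      {Y}      : List (Fin n)
      {t}      : Fin n
      path     : XPath y Y
      nonempty : 1 ≤ length Y
      outside  : Disjoint (y ∷ Y) L
      t∈L      : t ∈ L
      lands    : Adj (endpoint y Y) t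

  approach-via : ∀ {a α b t L} → XPath a α → Disjoint (a ∷ α) L → t ∈ L → Adj (endpoint a α) t →
                 Adj a b → b ∉ x ∷ L → Approach L
  approach-via {a} {α} {b} P dis t∈L lands ab b∉ with b ∈? a ∷ α
  ... | yes (here refl)  = ⊥-elim (subst T (irrefl G a) ab)
  ... | yes (there b∈α) = record { path = P ; nonempty = nonempty b∈α ; outside = dis ; t∈L = t∈L ; lands = lands }
    where
    nonempty : ∀ {α′} → b ∈ α′ → 1 ≤ length α′
    nonempty (here _)  = s≤s z≤n
    nonempty (there _) = s≤s z≤n
  ... | no b∉α = record
    { path     = record
      { simple = Unique-∷ b∉α (proj₁ (XPath.simple P)) , Adj-sym G ab ∷ proj₂ (XPath.simple P)
      ; avoids = λ { (here x≡b) → b∉ (here (sym x≡b)) ; (there x∈) → XPath.avoids P x∈ } }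
    ; nonempty = s≤s z≤n
    ; outside  = λ { (here refl , b∈L) → b∉ (there b∈L) ; (there p , q) → dis (p , q) }
    ; t∈L      = t∈L
    ; lands    = lands }

  -- Walk from the edge ab towards u inside G - x and stop at the first vertex of the path.
  approach : ∀ {u M} → XPath u M → EdgeOff (x ∷ u ∷ M) → Approach (u ∷ M)
  approach {u} {M} P (a , b , ab , a∉ , b∉) with connect a u (a∉ ∘ here) (XPath.avoids P ∘ here ∘ sym)
  ... | inj₁ a≡u = ⊥-elim (a∉ (there (here a≡u)))
  ... | inj₂ (Z , Q , end) with firstCommon _≟_ (a ∷ Z) (u ∷ M) (endpoint-∈ a Z) (subst (_∈ u ∷ M) (sym end) (here refl))
  ...   | [] , _ , _ , refl , a∈P , _ = ⊥-elim (a∉ (there a∈P))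
  ...   | _ ∷ α , t , β , refl , t∈P , α∩P =
    approach-via (record { simple = SimplePath-++⁻ˡ (a ∷ α) (XPath.simple Q) ; avoids = XPath.avoids Q ∘ ∈-++⁺ˡ })
                 α∩P t∈P (Linked-middle a α (proj₂ (XPath.simple Q))) ab b∉

  module Continue {u M} (A : Approach (u ∷ M)) (P : XPath u M) where
    open Approach A

    continue : ∀ {T} → SimplePath Adj (t ∷ T) → t ∷ T ⊆ u ∷ M → XPath y (Y ++ t ∷ T)
    continue S T⊆P = record
      { simple = SimplePath-join y Y (XPath.simple path) S (λ (p , q) → outside (p , T⊆P q)) lands
      ; avoids = λ x∈ → [ XPath.avoids path , XPath.avoids P ∘ T⊆P ]′ (∈-++⁻ (y ∷ Y) x∈) }

    module _ {L₁ L₂} (split : u ∷ M ≡ L₁ ++ t ∷ L₂) where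

      forward : XPath y (Y ++ t ∷ L₂)
      forward = continue (SimplePath-++⁻ʳ L₁ (subst (SimplePath Adj) split (XPath.simple P)))
                         (subst (_ ∈_) (sym split) ∘ ∈-++⁺ʳ L₁)

      backward : XPath y (Y ++ t ∷ reverse L₁)
      backward = continue (SimplePath-backward (Adj-sym G) L₁ L₂ (subst (SimplePath Adj) split (XPath.simple P)))
                          (subst (_ ∈_) (sym split) ∘ backward-⊆ L₁ t L₂)

      bound : 4 + length M ≤ length (Y ++ t ∷ L₂) + length (Y ++ t ∷ reverse L₁)
      bound = begin
        4 + length M                        ≡⟨ cong (3 +_) (trans (cong length split) (length-++ L₁)) ⟩
        3 + (length L₁ + suc (length L₂))    ≤⟨ halves-bound {length Y} {length L₁} {length L₂} nonempty ⟩
        (length Y + suc (length L₂)) + (length Y + suc (length L₁))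
          ≡⟨ sym (cong₂ _+_ (length-++ Y) (trans (length-++ Y) (cong (λ l → length Y + suc l) (length-reverse L₁)))) ⟩
        length (Y ++ t ∷ L₂) + length (Y ++ t ∷ reverse L₁) ∎
        where open ≤-Reasoning

  -- Continue the approach along the longer of the two halves into which t cuts the path.
  extend-via : ∀ {u M} → XPath u M → Approach (u ∷ M) → ∃[ y ] ∃[ M′ ] XPath y M′ × 4 + length M ≤ 2 * length M′
  extend-via P A with ∈-∃++ (Approach.t∈L A)
  ... | L₁ , L₂ , split
    with longer-of-two {a = length (Y ++ t ∷ L₂)} {b = length (Y ++ t ∷ reverse L₁)} (Continue.bound A P split)
    where open Approach A
  ...   | inj₁ forward-longer  = _ , _ , Continue.forward A P split , forward-longer
  ...   | inj₂ backward-longer = _ , _ , Continue.backward A P split , backward-longer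

  extend : ∀ {u M} → XPath u M → 2 ≤ length M → ∃[ y ] ∃[ M′ ] XPath y M′ × 4 + length M ≤ 2 * length M′
  extend P long = extend-via P (approach P (edge-off-path P long))

  long-path : 4 ≤ n → ∃[ u ] ∃[ M ] XPath u M × 2 ≤ length M
  long-path 4≤n with three-others x 4≤n
  ... | p , q , r , p≢x , q≢x , r≢x , p≢q , p≢r , q≢r with connect p q p≢x q≢x
  ... | inj₁ p≡q                  = ⊥-elim (p≢q p≡q)
  ... | inj₂ ([] , _ , p≡q)       = ⊥-elim (p≢q p≡q)
  ... | inj₂ (_ ∷ _ ∷ _ , P , _)  = p , _ , P , s≤s (s≤s z≤n)
  ... | inj₂ (_ ∷ [] , P , refl) with connect r p r≢x p≢x
  ...   | inj₁ r≡p                 = ⊥-elim (p≢r (sym r≡p))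
  ...   | inj₂ ([] , _ , r≡p)      = ⊥-elim (p≢r (sym r≡p))
  ...   | inj₂ (_ ∷ _ ∷ _ , R , _) = r , _ , R , s≤s (s≤s z≤n)
  ...   | inj₂ (_ ∷ [] , R , refl) = r , p ∷ q ∷ [] , record
          { simple = Unique-∷ (λ { (here r≡p) → p≢r (sym r≡p) ; (there (here r≡q)) → q≢r (sym r≡q) }) (proj₁ (XPath.simple P))
                   , Linked.head (proj₂ (XPath.simple R)) ∷ proj₂ (XPath.simple P)
          ; avoids = λ { (here x≡r) → r≢x (sym x≡r) ; (there x∈) → XPath.avoids P x∈ } }
          , s≤s (s≤s z≤n)

  path+edge≤n : ∀ {u M} → XPath u M → EdgeOff (x ∷ u ∷ M) → 4 + length M ≤ n
  path+edge≤n {u} {M} P (a , b , ab , a∉ , b∉) = Unique-length≤ {xs = a ∷ b ∷ x ∷ u ∷ M}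
    (Unique-∷ (λ { (here refl) → subst T (irrefl G a) ab ; (there a∈) → a∉ a∈ })
      (Unique-∷ b∉ (Unique-∷ (XPath.avoids P) (proj₁ (XPath.simple P)))))

  -- Two extensions of a path on three vertices give one on at least five, and an edge off it
  -- together with x gives three more vertices.
  8≤n : 4 ≤ n → 8 ≤ n
  8≤n 4≤n =
    let _ , M  , P  , 2≤M    = long-path 4≤n
        _ , M₁ , P₁ , bound₁ = extend P 2≤M
        3≤M₁                 = 2*-cancel-≤ (≤-trans (+-monoʳ-≤ 4 2≤M) (≤-trans bound₁ (n≤1+n _)))
        _ , M₂ , P₂ , bound₂ = extend P₁ (≤-trans (n≤1+n 2) 3≤M₁)
        4≤M₂                 = 2*-cancel-≤ (s≤s (≤-trans (+-monoʳ-≤ 4 3≤M₁) bound₂))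
    in ≤-trans (+-monoʳ-≤ 4 4≤M₂) (path+edge≤n P₂ (edge-off-path P₂ (≤-trans (m≤m+n 2 2) 4≤M₂)))

  module Rooted (r : Fin n) (r≢x : r ≢ x) where

    route : ∀ v → v ≢ x → ∃[ M ] XPath v M × endpoint v M ≡ r
    route v v≢x with connect v r v≢x r≢x
    ... | inj₁ refl = [] , XPath-[] v≢x , refl
    ... | inj₂ to-r = to-r

    next : List (Fin n) → Fin n
    next []      = x
    next (w ∷ _) = w

    abstract
      parent : Fin n → Fin n
      parent v with v ≟ x
      ... | yes _   = x
      ... | no v≢x = next (proj₁ (route v v≢x))

      parent-spec : ∀ {v M} → XPath v M → endpoint v M ≡ r → parent v ≡ next M
      parent-spec {v} {M} P end with v ≟ x
      ... | yes v≡x = ⊥-elim (XPath.avoids P (here (sym v≡x)))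
      ... | no v≢x with route v v≢x
      ...   | M′ , P′ , end′ = cong next (XPath-unique P′ P (trans end′ (sym end)))

      parent-x : parent x ≡ x
      parent-x with x ≟ x
      ... | yes _  = refl
      ... | no x≢x = ⊥-elim (x≢x refl)

    parent-root : parent r ≡ x
    parent-root = parent-spec (XPath-[] r≢x) refl

    parent-≢x : ∀ {v} → v ≢ x → v ≢ r → parent v ≢ x
    parent-≢x {v} v≢x v≢r with route v v≢x
    ... | []    , _ , v≡r = ⊥-elim (v≢r v≡r)
    ... | b ∷ M , P , end = λ parent≡x → XPath.avoids P (there (here (sym (trans (sym (parent-spec P end)) parent≡x))))

    parent-Adj : ∀ {i j} → i ≢ x → j ≢ x → parent i ≡ j → Adj i j
    parent-Adj {i} {j} i≢x j≢x parent≡j with route i i≢x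
    ... | []    , P , end = ⊥-elim (j≢x (trans (sym parent≡j) (parent-spec P end)))
    ... | b ∷ M , P , end = subst (Adj i) (trans (sym (parent-spec P end)) parent≡j) (Linked.head (proj₂ (XPath.simple P)))

    -- Either j is off i's route to r, and then i is next on j's route, or j is on it, and then
    -- right after i, as otherwise the edge ij would close a cycle.
    Adj⇒parent : ∀ {i j} → i ≢ x → j ≢ x → Adj i j → parent i ≡ j ⊎ parent j ≡ i
    Adj⇒parent {i} {j} i≢x j≢x ij with route i i≢x
    ... | M , P , end with j ∈? i ∷ M
    ...   | no j∉ = inj₂ (parent-spec (record
                { simple = Unique-∷ j∉ (proj₁ (XPath.simple P)) , Adj-sym G ij ∷ proj₂ (XPath.simple P)
                ; avoids = λ { (here x≡j) → j≢x (sym x≡j) ; (there x∈) → XPath.avoids P x∈ } }) end)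
    ...   | yes (here refl) = ⊥-elim (subst T (irrefl G i) ij)
    ...   | yes (there j∈M) = inj₁ (revisit P end j∈M)
      where
      revisit : ∀ {M′} → XPath i M′ → endpoint i M′ ≡ r → j ∈ M′ → parent i ≡ j
      revisit {b ∷ _} P′ end′ (here refl) = parent-spec P′ end′
      revisit {b ∷ _} P′ end′ (there j∈M₀) with ∈-∃++ j∈M₀
      ... | γ , δ , refl =
        ⊥-elim (XPath-unclosable (XPath-prefix (b ∷ γ ∷ʳ j) (subst (XPath i) (cong (b ∷_) (sym (++-assoc γ [ j ] δ))) P′))
                 (s≤s (length-++-∷ γ j []))
                 (subst (λ v → Adj v i) (sym (endpoint-∷ʳ i (b ∷ γ) j)) (Adj-sym G ij)))

    parent-asym : ∀ {i j} → i ≢ x → parent i ≡ j → parent j ≢ i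
    parent-asym {i} {j} i≢x parent≡j with route i i≢x
    ... | []    , P , end = λ parent≡i → i≢x (trans (sym parent≡i)
                              (trans (cong parent (trans (sym parent≡j) (parent-spec P end))) parent-x))
    ... | b ∷ M , P , end with trans (sym (parent-spec P end)) parent≡j
    ...   | refl = λ parent≡i → back-to-i M (trans (sym (parent-spec (XPath-tail P) end)) parent≡i) (proj₁ (XPath.simple P))
      where
      back-to-i : ∀ M′ → next M′ ≡ i → ¬ Unique (i ∷ b ∷ M′)
      back-to-i []      next≡i _ = i≢x (sym next≡i)
      back-to-i (c ∷ _) c≡i    u = Unique[x∷xs]⇒x∉xs u (there (here (sym c≡i)))

    -- Orient every edge of G - x towards r, and every edge at x away from x except xr.
    abstract
      out : Fin n → Fin n → ℕ
      out i j = if ⌊ i ≟ x ⌋ then (if ⌊ j ≟ r ⌋ then 0 else 𝟙 (adj G i j)) else 𝟙 ⌊ parent i ≟ j ⌋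

      out-x-r : out x r ≡ 0
      out-x-r with x ≟ x | r ≟ r
      ... | yes _  | yes _  = refl
      ... | no x≢x | _      = ⊥-elim (x≢x refl)
      ... | _      | no r≢r = ⊥-elim (r≢r refl)

      out-≢x : ∀ {i} → i ≢ x → ∀ j → out i j ≡ 𝟙 ⌊ parent i ≟ j ⌋
      out-≢x {i} i≢x j with i ≟ x
      ... | yes i≡x = ⊥-elim (i≢x i≡x)
      ... | no _    = refl

      out-x-≢r : ∀ {j} → j ≢ r → out x j ≡ 𝟙 (adj G x j)
      out-x-≢r {j} j≢r with x ≟ x | j ≟ r
      ... | yes _  | no _   = refl
      ... | no x≢x | _      = ⊥-elim (x≢x refl)
      ... | _      | yes j≡r = ⊥-elim (j≢r j≡r)

    x-edge-r : out x r + out r x ≡ 𝟙 (adj G x r)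
    x-edge-r = trans (cong₂ _+_ out-x-r (trans (out-≢x r≢x x) (𝟙-yes (parent r ≟ x) parent-root)))
                     (sym (cong 𝟙 (x-adjacent r (r≢x ∘ sym))))

    x-edge-≢r : ∀ {j} → j ≢ x → j ≢ r → out x j + out j x ≡ 𝟙 (adj G x j)
    x-edge-≢r j≢x j≢r = trans (cong₂ _+_ (out-x-≢r j≢r) (trans (out-≢x j≢x x) (𝟙-no (parent _ ≟ x) (parent-≢x j≢x j≢r))))
                              (+-identityʳ _)

    x-edge : ∀ {j} → j ≢ x → out x j + out j x ≡ 𝟙 (adj G x j)
    x-edge {j} j≢x with j ≟ r
    ... | yes j≡r = subst (λ v → out x v + out v x ≡ 𝟙 (adj G x v)) (sym j≡r) x-edge-r
    ... | no j≢r  = x-edge-≢r j≢x j≢r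

    tree-edge : ∀ {i j} → i ≢ x → j ≢ x → out i j + out j i ≡ 𝟙 (adj G i j)
    tree-edge {i} {j} i≢x j≢x with adj G i j in ij
    ... | true with Adj⇒parent i≢x j≢x (true⇒Adj ij)
    ...   | inj₁ i→j = cong₂ _+_ (trans (out-≢x i≢x j) (𝟙-yes (parent i ≟ j) i→j))
                                 (trans (out-≢x j≢x i) (𝟙-no (parent j ≟ i) (parent-asym i≢x i→j)))
    ...   | inj₂ j→i = cong₂ _+_ (trans (out-≢x i≢x j) (𝟙-no (parent i ≟ j) (parent-asym j≢x j→i)))
                                 (trans (out-≢x j≢x i) (𝟙-yes (parent j ≟ i) j→i))
    tree-edge {i} {j} i≢x j≢x | false =
      cong₂ _+_ (trans (out-≢x i≢x j) (𝟙-no (parent i ≟ j) (subst T ij ∘ parent-Adj i≢x j≢x)))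
                (trans (out-≢x j≢x i) (𝟙-no (parent j ≟ i) (subst T ij ∘ Adj-sym G ∘ parent-Adj j≢x i≢x)))

    orientation : ∀ i j → out i j + out j i ≡ 𝟙 (adj G i j)
    orientation i j with i ≟ x | j ≟ x
    ... | yes refl | yes refl = trans (cong₂ _+_ out-xx out-xx) (cong 𝟙 (sym (irrefl G x)))
      where
      out-xx : out x x ≡ 0
      out-xx = trans (out-x-≢r (r≢x ∘ sym)) (cong 𝟙 (irrefl G x))
    ... | yes refl | no j≢x   = x-edge j≢x
    ... | no i≢x   | yes refl = trans (+-comm (out i x) (out x i)) (trans (x-edge i≢x) (cong 𝟙 (Graph.sym G x i)))
    ... | no i≢x   | no j≢x   = tree-edge i≢x j≢x

    except-one : ∀ (f g : Fin n → ℕ) d → (∀ i → i ≢ d → f i ≡ g i) → ∑[ allFin n ] f + g d ≡ ∑[ allFin n ] g + f d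
    except-one f g d = ∑-except _≟_ f g (allFin⁺ n) (∈-allFin d)

    degree-x : degree G x + 1 ≡ n
    degree-x = begin
      degree G x + 1                            ≡⟨ except-one (𝟙 ∘ adj G x) (λ _ → 1) x (λ j j≢x → cong 𝟙 (x-adjacent j (j≢x ∘ sym))) ⟩
      ∑[ allFin n ] (λ _ → 1) + 𝟙 (adj G x x) ≡⟨ cong₂ _+_ (trans (∑-allFin-const n 1) (*-identityʳ n)) (cong 𝟙 (irrefl G x)) ⟩
      n + 0                                     ≡⟨ +-identityʳ n ⟩
      n                                         ∎
      where open ≡-Reasoning

    row : Fin n → ℕ
    row i = ∑[ allFin n ] (out i)

    row-x : row x + 1 ≡ degree G x
    row-x = begin
      row x + 1               ≡⟨ cong (row x +_) (cong 𝟙 (sym (x-adjacent r (r≢x ∘ sym)))) ⟩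
      row x + 𝟙 (adj G x r) ≡⟨ except-one (out x) (𝟙 ∘ adj G x) r (λ j → out-x-≢r) ⟩
      degree G x + out x r   ≡⟨ cong (degree G x +_) out-x-r ⟩
      degree G x + 0         ≡⟨ +-identityʳ (degree G x) ⟩
      degree G x             ∎
      where open ≡-Reasoning

    row-≢x : ∀ {i} → i ≢ x → row i ≡ 1
    row-≢x {i} i≢x = begin
      row i                                    ≡⟨ sym (+-identityʳ (row i)) ⟩
      row i + 0                                ≡⟨ except-one (out i) (λ _ → 0) (parent i)
                                                    (λ j j≢p → trans (out-≢x i≢x j) (𝟙-no (parent i ≟ j) (j≢p ∘ sym))) ⟩
      ∑[ allFin n ] (λ _ → 0) + out i (parent i) ≡⟨ cong₂ _+_ (trans (∑-allFin-const n 0) (*-zeroʳ n))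
                                                              (trans (out-≢x i≢x (parent i)) (𝟙-yes (parent i ≟ parent i) refl)) ⟩
      1                                        ∎
      where open ≡-Reasoning

    edgeCount+3 : edgeCount G + 3 ≡ n + n
    edgeCount+3 = begin
      edgeCount G + 3               ≡⟨ cong (_+ 3) (edgeCount-orientation G out orientation) ⟩
      ∑[ allFin n ] row + 3         ≡⟨ sym (+-assoc (∑[ allFin n ] row) 1 2) ⟩
      ∑[ allFin n ] row + 1 + 2     ≡⟨ cong (_+ 2) (except-one row (λ _ → 1) x (λ i → row-≢x)) ⟩
      ∑[ allFin n ] (λ _ → 1) + row x + 2 ≡⟨ cong (λ k → k + row x + 2) (trans (∑-allFin-const n 1) (*-identityʳ n)) ⟩
      n + row x + 2                 ≡⟨ +-assoc n (row x) 2 ⟩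
      n + (row x + 2)               ≡⟨ cong (n +_) (sym (+-assoc (row x) 1 1)) ⟩
      n + (row x + 1 + 1)           ≡⟨ cong (λ k → n + (k + 1)) row-x ⟩
      n + (degree G x + 1)          ≡⟨ cong (n +_) degree-x ⟩
      n + n                         ∎
      where open ≡-Reasoning

lemma3p8 : ∀ {n : ℕ} (G : Graph n) → 6 ≤ n → Good G → Saturated G →
    (x : Fin n) → (∀ u ms w → IsCycle (adj G) u ms w → x ∈ seq u ms w) →
    (degree G x ≡ n ∸ 1) × TreeMinus G x × (edgeCount G ≡ 2 * n ∸ 3) × (8 ≤ n)
lemma3p8 {n} G 6≤n ((_ , _ , no-cut-vertex) , _) (_ , saturated) x x∈cycles
  with r , _ , _ , r≢x , _ ← three-others x (≤-trans (m≤m+n 4 2) 6≤n) =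
  m+n≡o⇒m≡o∸n degree-x ,
  (no-cut-vertex x , x∈cycles) ,
  m+n≡o⇒m≡o∸n (trans edgeCount+3 (cong (n +_) (sym (+-identityʳ n)))) ,
  8≤n (≤-trans (m≤m+n 4 2) 6≤n)
  where
  open Saturation G x x∈cycles saturated (no-cut-vertex x)
  open Rooted r r≢x
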